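{- Let $p$ be a prime, let $m$ be a positive integer and let $\alpha\in\mathbb Z_p$. Then there is a $\mathrm{pReLU}$-network of width $2$ (input and output dimension $1$) which computes the function $f_\alpha:\mathbb Z_p\to\mathbb Z_p$ given by $f_\alpha(x)=\alpha$ if $x\in\alpha+p^m\mathbb Z_p$, and $f_\alpha(x)=x$ otherwise.
   Context: $\mathbb Q_p$ denotes the $p$-adic numbers and $\mathbb Z_p$ the $p$-adic integers. The function $\mathrm{pReLU}:\mathbb Q_p\to\mathbb Q_p$ is defined by $\mathrm{pReLU}(x)=x$ if $x\in\mathbb Z_p$ and $0$ otherwise. A $\mathrm{pReLU}$-network with input dimension $d_x$, output dimension $d_y$ and hidden layer dimensions $d_1,\dots,d_{L-1}$ is a composition $t_L\circ\Sigma_{L-1}\circ t_{L-1}\circ\cdots\circ t_2\circ\Sigma_1\circ t_1:\mathbb Q_p^{d_x}\to\mathbb Q_p^{d_y}$, where (with $d_0=d_x$, $d_L=d_y$) each $t_l:\mathbb Q_p^{d_{l-1}}\to\mathbb Q_p^{d_l}$ is an affine map with coefficients in $\mathbb Q_p$ and $\Sigma_l$ applies $\mathrm{pReLU}$ to each coordinate. Its width is $\max(d_1,\dots,d_{L-1})$. A network computes a function $f$ on a set $X$ if its restriction to $X$ equals $f$. -}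

module Defs where

open import Data.Nat using (ℕ; zero; suc; _+_; _*_; _∸_; _^_; _⊔_; NonZero)
open import Data.Nat.Properties using (_≟_; m^n≢0)
open import Data.Nat.DivMod using (_/_; _%_; _mod_)
open import Data.Nat.Primality using (Prime; prime⇒nonZero)
open import Data.Fin using (Fin; toℕ)
import Data.Fin as Fin
open import Data.Product using (_×_; _,_)
open import Relation.Binary.PropositionalEquality using (_≡_)
open import Relation.Nullary using (yes; no)

module Padic (p : ℕ) (pr : Prime p) where

  instance
    p≢0 : NonZero p
    p≢0 = prime⇒nonZero pr

  pw : ℕ → ℕ
  pw n = p ^ n

  -- a p-adic integer is its (canonical) digit expansion  x = Σ_i x i · p^i
  ℤp : Set
  ℤp = ℕ → Fin p

  _≈ℤ_ : ℤp → ℤp → Set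
  x ≈ℤ y = ∀ n → x n ≡ y n

  trunc : ℤp → ℕ → ℕ
  trunc x zero    = 0
  trunc x (suc n) = trunc x n + toℕ (x n) * p ^ n

  -- the p-adic integer whose residue mod p^n is r n (r assumed compatible)
  fromRes : (ℕ → ℕ) → ℤp
  fromRes r n = (_/_ (r (suc n)) (p ^ n) {{m^n≢0 p n}}) mod p

  _%p^_ : ℕ → ℕ → ℕ
  a %p^ n = _%_ a (p ^ n) {{m^n≢0 p n}}

  0ℤ : ℤp
  0ℤ _ = 0 mod p

  _+ℤ_ : ℤp → ℤp → ℤp
  x +ℤ y = fromRes (λ n → (trunc x n + trunc y n) %p^ n)

  _*ℤ_ : ℤp → ℤp → ℤp
  x *ℤ y = fromRes (λ n → (trunc x n * trunc y n) %p^ n)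

  -ℤ_ : ℤp → ℤp
  -ℤ x = fromRes (λ n → (p ^ n ∸ trunc x n) %p^ n)

  up : ℤp → ℕ → ℤp
  up y k = fromRes (λ n → (trunc y n * p ^ k) %p^ n)

  -- division by p^k (exact when the first k digits vanish)
  down : ℤp → ℕ → ℤp
  down y k i = y (i + k)

  -- ℚ_p: the pair (y , k) represents p^(-k) · y
  ℚp : Set
  ℚp = ℤp × ℕ

  _≈_ : ℚp → ℚp → Set
  (y , k) ≈ (y' , k') = up y k' ≈ℤ up y' k

  ι : ℤp → ℚp
  ι x = (x , 0)

  0ℚ : ℚp
  0ℚ = ι 0ℤ

  _+ℚ_ : ℚp → ℚp → ℚp
  (y , k) +ℚ (y' , k') = ((up y k' +ℤ up y' k) , k + k')

  _*ℚ_ : ℚp → ℚp → ℚp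
  (y , k) *ℚ (y' , k') = ((y *ℤ y') , k + k')

  -- pReLU(x) = x if x ∈ ℤ_p, 0 otherwise;  (y , k) ∈ ℤ_p  iff  p^k ∣ y
  pReLU : ℚp → ℚp
  pReLU (y , k) with trunc y k ≟ 0
  ... | yes _ = (down y k , 0)
  ... | no _  = 0ℚ

  sumℚ : ∀ {n} → (Fin n → ℚp) → ℚp
  sumℚ {zero}  v = 0ℚ
  sumℚ {suc n} v = v Fin.zero +ℚ sumℚ (λ i → v (Fin.suc i))

  record Affine (a b : ℕ) : Set where
    field
      weight : Fin b → Fin a → ℚp
      bias   : Fin b → ℚp

  applyAffine : ∀ {a b} → Affine a b → (Fin a → ℚp) → (Fin b → ℚp)
  applyAffine t x i = sumℚ (λ j → Affine.weight t i j *ℚ x j) +ℚ Affine.bias t i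

  data Net : ℕ → ℕ → Set where
    output : ∀ {a b} → Affine a b → Net a b
    hidden : ∀ {a c b} → Affine a c → Net c b → Net a b

  eval : ∀ {a b} → Net a b → (Fin a → ℚp) → (Fin b → ℚp)
  eval (output t)   x = applyAffine t x
  eval (hidden t n) x = eval n (λ i → pReLU (applyAffine t x i))

  width : ∀ {a b} → Net a b → ℕ
  width (output t)           = 0
  width (hidden {c = c} t n) = c ⊔ width n

  fα : ℕ → ℤp → ℤp → ℤp
  fα m α x with trunc x m ≟ trunc α m
  ... | yes _ = α
  ... | no _  = x

-- The first layer computes h₀ = x − α and h₁ = p⁻ᵐ (x − α).  pReLU fixes h₀, which lies in ℤ_p,
-- and keeps h₁ exactly when x ∈ α + pᵐ ℤ_p, killing it otherwise; so the output h₀ − pᵐ h₁ + α is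
-- α on that ball and x off it.  Since every operation on ℤ_p in the model is defined digitwise from
-- residues, each identity is checked on residues modulo pⁿ, i.e. by congruences in ℤ.
module Submission where

open import Defs
open import Level using (0ℓ)
open import Data.Nat as ℕ using (ℕ; zero; suc; NonZero; _≤_)
import Data.Nat.Properties as ℕ
import Data.Nat.Divisibility as ℕ
open import Data.Nat.DivMod using (_%_; _/_; m≡m%n+[m/n]*n; m%n<n; m<n⇒m%n≡m; m<n*o⇒m/o<n; m%n≤m)
open import Data.Nat.Primality using (Prime)
open import Data.Nat.Tactic.RingSolver using (solve-∀)
open import Data.Integer as ℤ using (ℤ; +_; ∣_∣)
import Data.Integer.Properties as ℤ
open import Data.Integer.Divisibility.Signed
import Data.Integer.Tactic.RingSolver as ℤ-Solver
open import Data.Fin using (Fin; toℕ; zero; suc)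
import Data.Fin.Properties as Fin
open import Data.Vec.Functional using ([]; _∷_)
open import Data.Product using (Σ; _×_; _,_; proj₁)
open import Function.Base using (_∘_)
open import Function.Bundles using (_⇔_; mk⇔; module Equivalence)
open import Relation.Binary.Bundles using (Setoid)
open import Relation.Binary.Structures using (IsEquivalence)
open import Relation.Binary.PropositionalEquality
open import Relation.Nullary using (Dec; yes; no; contradiction)

module _ where
  open import Data.Integer using (_+_; _-_; _*_; -_)

  infix 4 _≡_mod_

  -- A record rather than a synonym for + q ∣ a - b, so that a and b can be inferred from a proof.
  record _≡_mod_ (a b : ℤ) (q : ℕ) : Set where
    constructor ∣-difference
    field divides-difference : + q ∣ a - b

  module _ {q : ℕ} where

    ≡⇒≡-mod : ∀ {a b} → a ≡ b → a ≡ b mod q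
    ≡⇒≡-mod {a} refl = ∣-difference (divides (+ 0) (trans (ℤ.+-inverseʳ a) (sym (ℤ.*-zeroˡ (+ q)))))

    ≡-mod-sym : ∀ {a b} → a ≡ b mod q → b ≡ a mod q
    ≡-mod-sym {a} {b} (∣-difference q∣a-b) = ∣-difference (subst (+ q ∣_) (lemma a b) (∣m⇒∣-m q∣a-b))
      where lemma : ∀ a b → - (a - b) ≡ b - a
            lemma = ℤ-Solver.solve-∀

    ≡-mod-trans : ∀ {a b c} → a ≡ b mod q → b ≡ c mod q → a ≡ c mod q
    ≡-mod-trans {a} {b} {c} (∣-difference q∣a-b) (∣-difference q∣b-c) =
      ∣-difference (subst (+ q ∣_) (lemma a b c) (∣m∣n⇒∣m+n q∣a-b q∣b-c))
      where lemma : ∀ a b c → (a - b) + (b - c) ≡ a - c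
            lemma = ℤ-Solver.solve-∀

    ≡-mod-isEquivalence : IsEquivalence (λ a b → a ≡ b mod q)
    ≡-mod-isEquivalence = record
      { refl = ≡⇒≡-mod refl ; sym = ≡-mod-sym ; trans = ≡-mod-trans }

    +-cong-mod : ∀ {a b c d} → a ≡ b mod q → c ≡ d mod q → a + c ≡ b + d mod q
    +-cong-mod {a} {b} {c} {d} (∣-difference q∣a-b) (∣-difference q∣c-d) =
      ∣-difference (subst (+ q ∣_) (lemma a b c d) (∣m∣n⇒∣m+n q∣a-b q∣c-d))
      where lemma : ∀ a b c d → (a - b) + (c - d) ≡ (a + c) - (b + d)
            lemma = ℤ-Solver.solve-∀

    *-cong-mod : ∀ {a b c d} → a ≡ b mod q → c ≡ d mod q → a * c ≡ b * d mod q
    *-cong-mod {a} {b} {c} {d} (∣-difference q∣a-b) (∣-difference q∣c-d) =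
      ∣-difference (subst (+ q ∣_) (lemma a b c d) (∣m∣n⇒∣m+n (∣m⇒∣m*n c q∣a-b) (∣n⇒∣m*n b q∣c-d)))
      where lemma : ∀ a b c d → (a - b) * c + b * (c - d) ≡ a * c - b * d
            lemma = ℤ-Solver.solve-∀

    neg-cong-mod : ∀ {a b} → a ≡ b mod q → - a ≡ - b mod q
    neg-cong-mod {a} {b} (∣-difference q∣a-b) = ∣-difference (subst (+ q ∣_) (lemma a b) (∣m⇒∣-m q∣a-b))
      where lemma : ∀ a b → - (a - b) ≡ - a - - b
            lemma = ℤ-Solver.solve-∀

  ≡-mod-setoid : ℕ → Setoid 0ℓ 0ℓ
  ≡-mod-setoid q = record { isEquivalence = ≡-mod-isEquivalence {q} }

  ≡-mod-weaken : ∀ r {q a b} → a ≡ b mod r ℕ.* q → a ≡ b mod q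
  ≡-mod-weaken r {q} (∣-difference rq∣a-b) = ∣-difference (∣-trans (divides (+ r) (ℤ.pos-* r q)) rq∣a-b)

  *-monoˡ-≡-mod : ∀ k {q a b} → a ≡ b mod q → + k * a ≡ + k * b mod k ℕ.* q
  *-monoˡ-≡-mod k {q} {a} {b} (∣-difference q∣a-b) =
    ∣-difference (subst₂ _∣_ (sym (ℤ.pos-* k q)) (lemma (+ k) a b) (*-monoʳ-∣ (+ k) q∣a-b))
    where lemma : ∀ k a b → k * (a - b) ≡ k * a - k * b
          lemma = ℤ-Solver.solve-∀

  +-*-≡-mod : ∀ a b q → + (a ℕ.+ b ℕ.* q) ≡ + a mod q
  +-*-≡-mod a b q = ∣-difference (divides (+ b) (begin
    + (a ℕ.+ b ℕ.* q) - + a  ≡⟨ cong (λ c → (+ a + c) - + a) (ℤ.pos-* b q) ⟩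
    (+ a + + b * + q) - + a  ≡⟨ lemma (+ a) (+ b * + q) ⟩
    + b * + q                ∎))
    where open ≡-Reasoning
          lemma : ∀ a c → (a + c) - a ≡ c
          lemma = ℤ-Solver.solve-∀

  ≡-mod-% : ∀ a q .{{_ : NonZero q}} → + a ≡ + (a % q) mod q
  ≡-mod-% a q = subst (λ c → + c ≡ + (a % q) mod q) (sym (m≡m%n+[m/n]*n a q))
    (+-*-≡-mod (a % q) (a / q) q)

  ≡-mod⇒≡ : ∀ {a b q} → a ℕ.< q → b ℕ.< q → + a ≡ + b mod q → a ≡ b
  ≡-mod⇒≡ {a} {b} {q} a<q b<q (∣-difference q∣a-b) =
    ℤ.+-injective (ℤ.i-j≡0⇒i≡j (+ a) (+ b) (ℤ.∣i∣≡0⇒i≡0 ∣a-b∣≡0))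
    where
    ∣a-b∣<q : ∣ + a - + b ∣ ℕ.< q
    ∣a-b∣<q = subst (ℕ._< q) (cong ∣_∣ (sym (ℤ.m-n≡m⊖n a b)))
      (ℕ.≤-<-trans (ℤ.∣m⊝n∣≤m⊔n a b) (ℕ.⊔-lub a<q b<q))
    ∣a-b∣≡0 : ∣ + a - + b ∣ ≡ 0
    ∣a-b∣≡0 with ∣ + a - + b ∣ ℕ.≟ 0
    ... | yes eq = eq
    ... | no neq = contradiction (ℕ.∣⇒≤ {{ℕ.≢-nonZero neq}} (∣⇒∣ᵤ q∣a-b)) (ℕ.<⇒≱ ∣a-b∣<q)

module ≡-mod-Reasoning (q : ℕ) where
  open import Relation.Binary.Reasoning.Setoid (≡-mod-setoid q) public

module _ (p : ℕ) (pr : Prime p) where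
  open Padic p pr
  open import Data.Nat using (_+_; _*_; _^_; _∸_; _<_; z≤n; s≤s)

  p^n≢0 : ∀ n → NonZero (p ^ n)
  p^n≢0 n = ℕ.m^n≢0 p n

  trunc< : ∀ x n → trunc x n < p ^ n
  trunc< x zero    = s≤s z≤n
  trunc< x (suc n) = begin-strict
    trunc x n + toℕ (x n) * p ^ n  <⟨ ℕ.+-monoˡ-< (toℕ (x n) * p ^ n) (trunc< x n) ⟩
    suc (toℕ (x n)) * p ^ n        ≤⟨ ℕ.*-monoˡ-≤ (p ^ n) (Fin.toℕ<n (x n)) ⟩
    p * p ^ n                      ∎
    where open ℕ.≤-Reasoning

  trunc-+ : ∀ y k n → trunc y (k + n) ≡ trunc y k + trunc (down y k) n * p ^ k
  trunc-+ y k zero = begin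
    trunc y (k + 0)      ≡⟨ cong (trunc y) (ℕ.+-identityʳ k) ⟩
    trunc y k            ≡⟨ ℕ.+-identityʳ (trunc y k) ⟨
    trunc y k + 0 * p ^ k ∎
    where open ≡-Reasoning
  trunc-+ y k (suc n) = begin
    trunc y (k + suc n)
      ≡⟨ cong (trunc y) (ℕ.+-suc k n) ⟩
    trunc y (k + n) + toℕ (y (k + n)) * p ^ (k + n)
      ≡⟨ cong₂ (λ a d → a + toℕ (y d) * p ^ (k + n)) (trunc-+ y k n) (ℕ.+-comm k n) ⟩
    trunc y k + t * p ^ k + d * p ^ (k + n)
      ≡⟨ cong (λ e → trunc y k + t * p ^ k + d * e) (ℕ.^-distribˡ-+-* p k n) ⟩
    trunc y k + t * p ^ k + d * (p ^ k * p ^ n)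
      ≡⟨ lemma (trunc y k) t d (p ^ k) (p ^ n) ⟩
    trunc y k + (t + d * p ^ n) * p ^ k
      ∎
    where
    open ≡-Reasoning
    t d : ℕ
    t = trunc (down y k) n
    d = toℕ (down y k n)
    lemma : ∀ a t d q r → a + t * q + d * (q * r) ≡ a + (t + d * r) * q
    lemma = solve-∀

  residue : ℤp → ℕ → ℤ
  residue x n = + trunc x n

  residue-+-≡-mod : ∀ y n j → residue y (n + j) ≡ residue y n mod p ^ n
  residue-+-≡-mod y n j rewrite trunc-+ y n j = +-*-≡-mod (trunc y n) (trunc (down y n) j) (p ^ n)

  residue-suc-≡-mod : ∀ y n → residue y (suc n) ≡ residue y n mod p ^ n
  residue-suc-≡-mod y n = +-*-≡-mod (trunc y n) (toℕ (y n)) (p ^ n)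

  trunc-injective : ∀ x y → (∀ n → trunc x n ≡ trunc y n) → x ≈ℤ y
  trunc-injective x y eq n = Fin.toℕ-injective (ℕ.*-cancelʳ-≡ (toℕ (x n)) (toℕ (y n)) (p ^ n) {{p^n≢0 n}}
    (ℕ.+-cancelˡ-≡ (trunc x n) _ _ (trans (eq (suc n)) (cong (_+ toℕ (y n) * p ^ n) (sym (eq n))))))

  trunc-fromRes : ∀ r → (∀ n → r n < p ^ n) → (∀ n → + r (suc n) ≡ + r n mod p ^ n) →
                  ∀ n → trunc (fromRes r) n ≡ r n
  trunc-fromRes r r< r-compatible zero    = sym (ℕ.n<1⇒n≡0 (r< 0))
  trunc-fromRes r r< r-compatible (suc n) = begin
    trunc (fromRes r) n + toℕ (fromRes r n) * p ^ n
      ≡⟨ cong₂ (λ a b → a + b * p ^ n) (trunc-fromRes r r< r-compatible n) toℕ-digit ⟩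
    r n + r (suc n) / p ^ n * p ^ n
      ≡⟨ cong (_+ r (suc n) / p ^ n * p ^ n) r-low ⟨
    r (suc n) % p ^ n + r (suc n) / p ^ n * p ^ n
      ≡⟨ m≡m%n+[m/n]*n (r (suc n)) (p ^ n) ⟨
    r (suc n)
      ∎
    where
    open ≡-Reasoning
    instance
      p^n-nonZero : NonZero (p ^ n)
      p^n-nonZero = p^n≢0 n
    toℕ-digit : toℕ (fromRes r n) ≡ r (suc n) / p ^ n
    toℕ-digit = trans (Fin.toℕ-fromℕ< _) (m<n⇒m%n≡m (m<n*o⇒m/o<n (r< (suc n))))
    r-low : r (suc n) % p ^ n ≡ r n
    r-low = ≡-mod⇒≡ (m%n<n (r (suc n)) (p ^ n)) (r< n)
      (≡-mod-trans (≡-mod-sym (≡-mod-% (r (suc n)) (p ^ n))) (r-compatible n))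

  infix 4 _HasResidues_

  _HasResidues_ : ℤp → (ℕ → ℤ) → Set
  x HasResidues r = ∀ n → residue x n ≡ r n mod p ^ n

  HasResidues-refl : ∀ x → x HasResidues residue x
  HasResidues-refl x n = ≡⇒≡-mod refl

  fromRes-residues : ∀ (S : ℕ → ℕ) {R} → (∀ n → + S n ≡ R n mod p ^ n) → (∀ n → R (suc n) ≡ R n mod p ^ n) →
                     fromRes (λ n → S n %p^ n) HasResidues R
  fromRes-residues S {R} S≡R R-compatible n = let open ≡-mod-Reasoning (p ^ n) in begin
    residue (fromRes (λ n → S n %p^ n)) n  ≡⟨ cong +_ (trunc-fromRes (λ n → S n %p^ n) reduced< reduced-compatible n) ⟩
    + (S n %p^ n)                           ≈⟨ reduced≡S n ⟨
    + (S n)                                 ≈⟨ S≡R n ⟩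
    R n                                     ∎
    where
    reduced≡S : ∀ n → + S n ≡ + (S n %p^ n) mod p ^ n
    reduced≡S n = ≡-mod-% (S n) (p ^ n) {{p^n≢0 n}}
    reduced< : ∀ n → S n %p^ n < p ^ n
    reduced< n = m%n<n (S n) (p ^ n) {{p^n≢0 n}}
    reduced-compatible : ∀ n → + (S (suc n) %p^ suc n) ≡ + (S n %p^ n) mod p ^ n
    reduced-compatible n = let open ≡-mod-Reasoning (p ^ n) in begin
      + (S (suc n) %p^ suc n)  ≈⟨ ≡-mod-weaken p (≡-mod-trans (≡-mod-sym (reduced≡S (suc n))) (S≡R (suc n))) ⟩
      R (suc n)                ≈⟨ R-compatible n ⟩
      R n                      ≈⟨ S≡R n ⟨
      + (S n)                  ≈⟨ reduced≡S n ⟩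
      + (S n %p^ n)            ∎

  +ℤ-residues : ∀ {x y r s} → x HasResidues r → y HasResidues s → (x +ℤ y) HasResidues (λ n → r n ℤ.+ s n)
  +ℤ-residues {x} {y} x≈r y≈s n = ≡-mod-trans
    (fromRes-residues (λ n → trunc x n + trunc y n) (λ _ → ≡⇒≡-mod refl)
      (λ n → +-cong-mod (residue-suc-≡-mod x n) (residue-suc-≡-mod y n)) n)
    (+-cong-mod (x≈r n) (y≈s n))

  *ℤ-residues : ∀ {x y r s} → x HasResidues r → y HasResidues s → (x *ℤ y) HasResidues (λ n → r n ℤ.* s n)
  *ℤ-residues {x} {y} x≈r y≈s n = ≡-mod-trans
    (fromRes-residues (λ n → trunc x n * trunc y n) (λ n → ≡⇒≡-mod (ℤ.pos-* (trunc x n) (trunc y n)))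
      (λ n → *-cong-mod (residue-suc-≡-mod x n) (residue-suc-≡-mod y n)) n)
    (*-cong-mod (x≈r n) (y≈s n))

  up-residues : ∀ {y r} k → y HasResidues r → up y k HasResidues (λ n → r n ℤ.* + (p ^ k))
  up-residues {y} k y≈r n = ≡-mod-trans
    (fromRes-residues (λ n → trunc y n * p ^ k) (λ n → ≡⇒≡-mod (ℤ.pos-* (trunc y n) (p ^ k)))
      (λ n → *-cong-mod (residue-suc-≡-mod y n) (≡⇒≡-mod refl)) n)
    (*-cong-mod (y≈r n) (≡⇒≡-mod refl))

  complement≡-residue : ∀ x n → + (p ^ n ∸ trunc x n) ≡ ℤ.- residue x n mod p ^ n
  complement≡-residue x n = subst (_≡ ℤ.- residue x n mod p ^ n) +[q∸t]≡+q-+t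
    (∣-difference (divides (+ 1) (lemma (+ (p ^ n)) (residue x n))))
    where
    +[q∸t]≡+q-+t : + (p ^ n) ℤ.- residue x n ≡ + (p ^ n ∸ trunc x n)
    +[q∸t]≡+q-+t = trans (ℤ.m-n≡m⊖n (p ^ n) (trunc x n)) (ℤ.⊖-≥ (ℕ.<⇒≤ (trunc< x n)))
    lemma : ∀ q t → (q ℤ.- t) ℤ.- (ℤ.- t) ≡ + 1 ℤ.* q
    lemma = ℤ-Solver.solve-∀

  -ℤ-residues : ∀ {x r} → x HasResidues r → (-ℤ x) HasResidues (λ n → ℤ.- r n)
  -ℤ-residues {x} x≈r n = ≡-mod-trans
    (fromRes-residues (λ n → p ^ n ∸ trunc x n) (complement≡-residue x)
      (λ n → neg-cong-mod (residue-suc-≡-mod x n)) n)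
    (neg-cong-mod (x≈r n))

  trunc-0ℤ : ∀ n → trunc 0ℤ n ≡ 0
  trunc-0ℤ zero    = refl
  trunc-0ℤ (suc n) =
    cong₂ (λ a d → a + d * p ^ n) (trunc-0ℤ n) (trans (Fin.toℕ-fromℕ< _) (ℕ.n≤0⇒n≡0 (m%n≤m 0 p)))

  0ℤ-residues : 0ℤ HasResidues (λ _ → + 0)
  0ℤ-residues n = ≡⇒≡-mod (cong +_ (trunc-0ℤ n))

  1ℤ : ℤp
  1ℤ = fromRes (λ n → 1 %p^ n)

  1ℤ-residues : 1ℤ HasResidues (λ _ → + 1)
  1ℤ-residues = fromRes-residues (λ _ → 1) (λ _ → ≡⇒≡-mod refl) (λ _ → ≡⇒≡-mod refl)

  residues-unique : ∀ {x y r} → x HasResidues r → y HasResidues r → ∀ n → trunc x n ≡ trunc y n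
  residues-unique {x} {y} x≈r y≈r n = ≡-mod⇒≡ (trunc< x n) (trunc< y n) (≡-mod-trans (x≈r n) (≡-mod-sym (y≈r n)))

  ι-≈-from-residues : ∀ {x y r} → x HasResidues r → y HasResidues r → ι x ≈ ι y
  ι-≈-from-residues x≈r y≈r = trunc-injective _ _ (residues-unique (up-residues 0 x≈r) (up-residues 0 y≈r))

  difference-trunc≡0⇔ : ∀ {x y z} → z HasResidues (λ n → residue x n ℤ.- residue y n) →
                        ∀ n → trunc z n ≡ 0 ⇔ trunc x n ≡ trunc y n
  difference-trunc≡0⇔ {x} {y} {z} z≈x-y n = mk⇔ to from
    where
    open ≡-mod-Reasoning (p ^ n)
    lemma : ∀ a b → (a ℤ.- b) ℤ.+ b ≡ a
    lemma = ℤ-Solver.solve-∀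
    to : trunc z n ≡ 0 → trunc x n ≡ trunc y n
    to z≡0 = ≡-mod⇒≡ (trunc< x n) (trunc< y n) (begin
      residue x n                                   ≡⟨ lemma (residue x n) (residue y n) ⟨
      (residue x n ℤ.- residue y n) ℤ.+ residue y n  ≈⟨ +-cong-mod (z≈x-y n) (≡⇒≡-mod refl) ⟨
      residue z n ℤ.+ residue y n                   ≡⟨ cong (λ c → + c ℤ.+ residue y n) z≡0 ⟩
      residue y n                                   ∎)
    from : trunc x n ≡ trunc y n → trunc z n ≡ 0
    from x≡y = ≡-mod⇒≡ (trunc< z n) (ℕ.m^n>0 p n) (begin
      residue z n                   ≈⟨ z≈x-y n ⟩
      residue x n ℤ.- residue y n   ≡⟨ cong (λ c → + c ℤ.- residue y n) x≡y ⟩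
      residue y n ℤ.- residue y n   ≡⟨ ℤ.+-inverseʳ (residue y n) ⟩
      + 0                           ∎)

  trunc-scaled : ∀ k {y z} → y HasResidues (λ n → + (p ^ k) ℤ.* residue z n) →
                 ∀ j → trunc y (k + j) ≡ p ^ k * trunc z j
  trunc-scaled k {y} {z} y≈pᵏz j = ≡-mod⇒≡ (trunc< y (k + j)) bound congruence
    where
    instance
      p^k-nonZero : NonZero (p ^ k)
      p^k-nonZero = p^n≢0 k
    p^[k+j]≡p^k*p^j : p ^ (k + j) ≡ p ^ k * p ^ j
    p^[k+j]≡p^k*p^j = ℕ.^-distribˡ-+-* p k j
    bound : p ^ k * trunc z j < p ^ (k + j)
    bound = subst (p ^ k * trunc z j <_) (sym p^[k+j]≡p^k*p^j) (ℕ.*-monoʳ-< (p ^ k) (trunc< z j))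
    z-low : residue z (k + j) ≡ residue z j mod p ^ j
    z-low = subst (λ i → residue z i ≡ residue z j mod p ^ j) (ℕ.+-comm j k) (residue-+-≡-mod z j k)
    congruence : residue y (k + j) ≡ + (p ^ k * trunc z j) mod p ^ (k + j)
    congruence = let open ≡-mod-Reasoning (p ^ (k + j)) in begin
      residue y (k + j)                 ≈⟨ y≈pᵏz (k + j) ⟩
      + (p ^ k) ℤ.* residue z (k + j)   ≈⟨ subst (+ (p ^ k) ℤ.* residue z (k + j) ≡ + (p ^ k) ℤ.* residue z j mod_)
                                             (sym p^[k+j]≡p^k*p^j) (*-monoˡ-≡-mod (p ^ k) z-low) ⟩
      + (p ^ k) ℤ.* residue z j         ≡⟨ ℤ.pos-* (p ^ k) (trunc z j) ⟨
      + (p ^ k * trunc z j)             ∎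

  trunc-down-scaled : ∀ k j {y z} → y HasResidues (λ n → + (p ^ k) ℤ.* residue z n) → trunc y (k + j) ≡ 0 →
                      ∀ n → trunc (down y (k + j)) n * p ^ j ≡ trunc z (j + n)
  trunc-down-scaled k j {y} {z} y≈pᵏz y-integral n = ℕ.*-cancelˡ-≡ _ _ (p ^ k) {{p^n≢0 k}} (begin
    p ^ k * (t * p ^ j)                  ≡⟨ lemma (p ^ k) t (p ^ j) ⟩
    t * (p ^ k * p ^ j)                  ≡⟨ cong (t *_) (ℕ.^-distribˡ-+-* p k j) ⟨
    t * p ^ (k + j)                      ≡⟨ cong (_+ t * p ^ (k + j)) y-integral ⟨
    trunc y (k + j) + t * p ^ (k + j)    ≡⟨ trunc-+ y (k + j) n ⟨
    trunc y (k + j + n)                  ≡⟨ cong (trunc y) (ℕ.+-assoc k j n) ⟩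
    trunc y (k + (j + n))                ≡⟨ trunc-scaled k y≈pᵏz (j + n) ⟩
    p ^ k * trunc z (j + n)              ∎)
    where
    open ≡-Reasoning
    t : ℕ
    t = trunc (down y (k + j)) n
    lemma : ∀ a t b → a * (t * b) ≡ t * (a * b)
    lemma = solve-∀

  down-scaled-residues : ∀ k j {y z} → y HasResidues (λ n → + (p ^ k) ℤ.* residue z n) → trunc y (k + j) ≡ 0 →
                         z HasResidues (λ n → + (p ^ j) ℤ.* residue (down y (k + j)) n)
  down-scaled-residues k j {y} {z} y≈pᵏz y-integral n = let open ≡-mod-Reasoning (p ^ n) in begin
    residue z n                                ≈⟨ residue-+-≡-mod z n j ⟨
    residue z (n + j)                          ≡⟨ cong (residue z) (ℕ.+-comm n j) ⟩
    residue z (j + n)                          ≡⟨ cong +_ (trunc-down-scaled k j y≈pᵏz y-integral n) ⟨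
    + (trunc (down y (k + j)) n * p ^ j)       ≡⟨ cong +_ (ℕ.*-comm _ (p ^ j)) ⟩
    + (p ^ j * trunc (down y (k + j)) n)       ≡⟨ ℤ.pos-* (p ^ j) _ ⟩
    + (p ^ j) ℤ.* residue (down y (k + j)) n   ∎

  down-zero-residues : ∀ {y r} → y HasResidues r → down y 0 HasResidues r
  down-zero-residues {y} y≈r n = ≡-mod-trans (≡⇒≡-mod (cong +_ trunc-down-zero)) (y≈r n)
    where
    trunc-down-zero : trunc (down y 0) n ≡ trunc y n
    trunc-down-zero = sym (trans (trunc-+ y 0 n) (ℕ.*-identityʳ (trunc (down y 0) n)))

  pReLU-integral : ∀ y k → trunc y k ≡ 0 → pReLU (y , k) ≡ ι (down y k)
  pReLU-integral y k integral with trunc y k ℕ.≟ 0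
  ... | yes _      = refl
  ... | no  ≢0     = contradiction integral ≢0

  pReLU-nonintegral : ∀ y k → trunc y k ≢ 0 → pReLU (y , k) ≡ 0ℚ
  pReLU-nonintegral y k nonintegral with trunc y k ℕ.≟ 0
  ... | yes ≡0 = contradiction ≡0 nonintegral
  ... | no  _  = refl

  sumℚ-cong : ∀ {n} {v w : Fin n → ℚp} → (∀ i → v i ≡ w i) → sumℚ v ≡ sumℚ w
  sumℚ-cong {zero}  v≡w = refl
  sumℚ-cong {suc n} v≡w = cong₂ _+ℚ_ (v≡w zero) (sumℚ-cong (v≡w ∘ suc))

  applyAffine-cong : ∀ {a b} (t : Affine a b) {v w} → (∀ j → v j ≡ w j) → ∀ i → applyAffine t v i ≡ applyAffine t w i
  applyAffine-cong t v≡w i = cong (_+ℚ Affine.bias t i) (sumℚ-cong (λ j → cong (Affine.weight t i j *ℚ_) (v≡w j)))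

  ≡-≈-trans : ∀ {a b c} → a ≡ b → b ≈ c → a ≈ c
  ≡-≈-trans refl b≈c = b≈c

  ≈-≡-trans : ∀ {a b c} → a ≈ b → b ≡ c → a ≈ c
  ≈-≡-trans a≈b refl = a≈b

  fα-inside : ∀ m α x → trunc x m ≡ trunc α m → fα m α x ≡ α
  fα-inside m α x x≡α with trunc x m ℕ.≟ trunc α m
  ... | yes _   = refl
  ... | no x≢α  = contradiction x≡α x≢α

  fα-outside : ∀ m α x → trunc x m ≢ trunc α m → fα m α x ≡ x
  fα-outside m α x x≢α with trunc x m ℕ.≟ trunc α m
  ... | yes x≡α = contradiction x≡α x≢α
  ... | no _    = refl

  module CollapseBall (m : ℕ) (α : ℤp) where

    pᵐ : ℤ
    pᵐ = + (p ^ m)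

    firstLayer : Affine 1 2
    Affine.weight firstLayer zero    _ = ι 1ℤ
    Affine.weight firstLayer (suc _) _ = (1ℤ , m)
    Affine.bias   firstLayer zero      = ι (-ℤ α)
    Affine.bias   firstLayer (suc _)   = (-ℤ α , m)

    secondLayer : Affine 2 1
    Affine.weight secondLayer _ zero    = ι 1ℤ
    Affine.weight secondLayer _ (suc _) = ι (-ℤ (up 1ℤ m))
    Affine.bias   secondLayer _         = ι α

    network : Net 1 1
    network = hidden firstLayer (output secondLayer)

    preactivation : ℤp → Fin 2 → ℚp
    preactivation x = applyAffine firstLayer (λ _ → ι x)

    -- preactivation x zero is (shifted x , 0) with shifted x = x − α, and preactivation x (suc zero),
    -- which is p⁻ᵐ (x − α), is (scaled x , scale) with scaled x = pᵐ (x − α) and scale = 2m.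
    shifted scaled : ℤp → ℤp
    shifted x = proj₁ (preactivation x zero)
    scaled  x = proj₁ (preactivation x (suc zero))

    -- The exponents as applyAffine produces them: the weight (1ℤ , m) gains "+ 0" from ι x and from
    -- the empty tail of the sum, and the bias (-ℤ α , m) adds another m.
    scale : ℕ
    scale = m + 0 + 0 + m

    m+0+0≡m : m + 0 + 0 ≡ m
    m+0+0≡m = trans (ℕ.+-identityʳ (m + 0)) (ℕ.+-identityʳ m)

    -- The chain of residue lemmas follows the term built by applyAffine; lemma then normalises it.
    shifted-residues : ∀ x → shifted x HasResidues (λ n → residue x n ℤ.- residue α n)
    shifted-residues x n = ≡-mod-trans
      (+ℤ-residues (up-residues 0 (+ℤ-residues (up-residues 0 (*ℤ-residues 1ℤ-residues (HasResidues-refl x)))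
                                               (up-residues 0 0ℤ-residues)))
                   (up-residues 0 (-ℤ-residues (HasResidues-refl α))) n)
      (≡⇒≡-mod (lemma (residue x n) (residue α n)))
      where
      lemma : ∀ a b → ((+ 1 ℤ.* a) ℤ.* + 1 ℤ.+ + 0 ℤ.* + 1) ℤ.* + 1 ℤ.+ ℤ.- b ℤ.* + 1 ≡ a ℤ.- b
      lemma = ℤ-Solver.solve-∀

    scaled-residues : ∀ x → scaled x HasResidues (λ n → pᵐ ℤ.* residue (shifted x) n)
    scaled-residues x n = let open ≡-mod-Reasoning (p ^ n) in begin
      residue (scaled x) n
        ≈⟨ +ℤ-residues (up-residues m (+ℤ-residues (up-residues 0 (*ℤ-residues 1ℤ-residues (HasResidues-refl x)))
                                                   (up-residues (m + 0) 0ℤ-residues)))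
                       (up-residues (m + 0 + 0) (-ℤ-residues (HasResidues-refl α))) n ⟩
      unfolded (+ (p ^ (m + 0 + 0)))           ≡⟨ cong (λ k → unfolded (+ (p ^ k))) m+0+0≡m ⟩
      unfolded pᵐ                              ≡⟨ lemma (residue x n) (residue α n) (+ (p ^ (m + 0))) pᵐ ⟩
      pᵐ ℤ.* (residue x n ℤ.- residue α n)     ≈⟨ *-cong-mod (≡⇒≡-mod {a = pᵐ} refl) (≡-mod-sym (shifted-residues x n)) ⟩
      pᵐ ℤ.* residue (shifted x) n             ∎
      where
      unfolded : ℤ → ℤ
      unfolded e = ((+ 1 ℤ.* residue x n) ℤ.* + 1 ℤ.+ + 0 ℤ.* + (p ^ (m + 0))) ℤ.* pᵐ ℤ.+ ℤ.- residue α n ℤ.* e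
      lemma : ∀ a b c d → ((+ 1 ℤ.* a) ℤ.* + 1 ℤ.+ + 0 ℤ.* c) ℤ.* d ℤ.+ ℤ.- b ℤ.* d ≡ d ℤ.* (a ℤ.- b)
      lemma = ℤ-Solver.solve-∀

    scaled-integral⇔ : ∀ x → trunc (scaled x) (m + m) ≡ 0 ⇔ trunc x m ≡ trunc α m
    scaled-integral⇔ x = mk⇔
      (λ scaled≡0 → to (ℕ.*-cancelˡ-≡ _ 0 (p ^ m) {{p^n≢0 m}}
                         (trans (sym trunc≡) (trans scaled≡0 (sym (ℕ.*-zeroʳ (p ^ m)))))))
      (λ x≡α → trans trunc≡ (trans (cong (p ^ m *_) (from x≡α)) (ℕ.*-zeroʳ (p ^ m))))
      where
      open Equivalence (difference-trunc≡0⇔ (shifted-residues x) m)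
      trunc≡ : trunc (scaled x) (m + m) ≡ p ^ m * trunc (shifted x) m
      trunc≡ = trunc-scaled m (scaled-residues x) m

    scaled-integral : ∀ x → trunc x m ≡ trunc α m → trunc (scaled x) scale ≡ 0
    scaled-integral x x≡α =
      subst (λ k → trunc (scaled x) (k + m) ≡ 0) (sym m+0+0≡m) (Equivalence.from (scaled-integral⇔ x) x≡α)

    hidden₁-active : ∀ x → trunc x m ≡ trunc α m → pReLU (preactivation x (suc zero)) ≡ ι (down (scaled x) (m + m))
    hidden₁-active x x≡α = trans (pReLU-integral (scaled x) scale (scaled-integral x x≡α))
                                 (cong (λ k → ι (down (scaled x) (k + m))) m+0+0≡m)

    hidden₁-inactive : ∀ x → trunc x m ≢ trunc α m → pReLU (preactivation x (suc zero)) ≡ ι 0ℤ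
    hidden₁-inactive x x≢α = pReLU-nonintegral (scaled x) scale λ scaled≡0 →
      x≢α (Equivalence.to (scaled-integral⇔ x) (subst (λ k → trunc (scaled x) (k + m) ≡ 0) m+0+0≡m scaled≡0))

    readout : ℤp → ℤp → ℚp
    readout h₀ h₁ = applyAffine secondLayer (ι h₀ ∷ ι h₁ ∷ []) zero

    readout-residues : ∀ h₀ h₁ →
                       proj₁ (readout h₀ h₁) HasResidues (λ n → residue h₀ n ℤ.- pᵐ ℤ.* residue h₁ n ℤ.+ residue α n)
    readout-residues h₀ h₁ n = ≡-mod-trans
      (+ℤ-residues (up-residues 0 (+ℤ-residues (up-residues 0 (*ℤ-residues 1ℤ-residues (HasResidues-refl h₀)))
                                               (up-residues 0 (+ℤ-residues (up-residues 0 (*ℤ-residues (-ℤ-residues (up-residues m 1ℤ-residues))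
                                                                                                         (HasResidues-refl h₁)))
                                                                           (up-residues 0 0ℤ-residues)))))
                   (up-residues 0 (HasResidues-refl α)) n)
      (≡⇒≡-mod (lemma (residue h₀ n) (residue h₁ n) (residue α n) pᵐ))
      where
      lemma : ∀ a b c q → ((+ 1 ℤ.* a) ℤ.* + 1 ℤ.+ ((ℤ.- (+ 1 ℤ.* q) ℤ.* b) ℤ.* + 1 ℤ.+ + 0 ℤ.* + 1) ℤ.* + 1) ℤ.* + 1 ℤ.+ c ℤ.* + 1
                          ≡ a ℤ.- q ℤ.* b ℤ.+ c
      lemma = ℤ-Solver.solve-∀

    eval-network : ∀ x {h₁} → pReLU (preactivation x (suc zero)) ≡ ι h₁ →
                   eval network (λ _ → ι x) zero ≡ readout (down (shifted x) 0) h₁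
    eval-network x {h₁} hidden₁≡ =
      applyAffine-cong secondLayer {v = pReLU ∘ preactivation x} {w = ι (down (shifted x) 0) ∷ ι h₁ ∷ []}
                       (λ { zero → refl ; (suc zero) → hidden₁≡ }) zero

    network-≈ : ∀ x {h₁ z} → pReLU (preactivation x (suc zero)) ≡ ι h₁ →
                (∀ n → residue (down (shifted x) 0) n ℤ.- pᵐ ℤ.* residue h₁ n ℤ.+ residue α n ≡ residue z n mod p ^ n) →
                eval network (λ _ → ι x) zero ≈ ι z
    -- Stating the implicit arguments of ≡-≈-trans keeps Agda from unfolding _≈_ and normalising the network.
    network-≈ x {h₁} {z} hidden₁≡ readout≡z =
      ≡-≈-trans {eval network (λ _ → ι x) zero} {readout h₀ h₁} {ι z} (eval-network x hidden₁≡)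
        (ι-≈-from-residues {proj₁ (readout h₀ h₁)} {z} (readout-residues h₀ h₁) (≡-mod-sym ∘ readout≡z))
      where
      h₀ : ℤp
      h₀ = down (shifted x) 0

    network-inside-ball : ∀ x → trunc x m ≡ trunc α m → eval network (λ _ → ι x) zero ≈ ι α
    network-inside-ball x x≡α = network-≈ x (hidden₁-active x x≡α) cancels
      where
      scaled≡0 : trunc (scaled x) (m + m) ≡ 0
      scaled≡0 = Equivalence.from (scaled-integral⇔ x) x≡α
      cancels : ∀ n → residue (down (shifted x) 0) n ℤ.- pᵐ ℤ.* residue (down (scaled x) (m + m)) n ℤ.+ residue α n
                      ≡ residue α n mod p ^ n
      cancels n = let open ≡-mod-Reasoning (p ^ n) in begin
        residue (down (shifted x) 0) n ℤ.- pᵐ ℤ.* residue (down (scaled x) (m + m)) n ℤ.+ residue α n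
          ≈⟨ +-cong-mod (+-cong-mod (down-zero-residues (HasResidues-refl (shifted x)) n)
                                    (neg-cong-mod (≡-mod-sym (down-scaled-residues m m (scaled-residues x) scaled≡0 n))))
                        (≡⇒≡-mod refl) ⟩
        residue (shifted x) n ℤ.- residue (shifted x) n ℤ.+ residue α n
          ≡⟨ cong (ℤ._+ residue α n) (ℤ.+-inverseʳ (residue (shifted x) n)) ⟩
        + 0 ℤ.+ residue α n
          ≡⟨ ℤ.+-identityˡ (residue α n) ⟩
        residue α n ∎

    network-outside-ball : ∀ x → trunc x m ≢ trunc α m → eval network (λ _ → ι x) zero ≈ ι x
    network-outside-ball x x≢α = network-≈ x (hidden₁-inactive x x≢α) restores
      where
      restores : ∀ n → residue (down (shifted x) 0) n ℤ.- pᵐ ℤ.* residue 0ℤ n ℤ.+ residue α n ≡ residue x n mod p ^ n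
      restores n = let open ≡-mod-Reasoning (p ^ n) in begin
        residue (down (shifted x) 0) n ℤ.- pᵐ ℤ.* residue 0ℤ n ℤ.+ residue α n
          ≈⟨ +-cong-mod (+-cong-mod (down-zero-residues (shifted-residues x) n)
                                    (neg-cong-mod (*-cong-mod (≡⇒≡-mod {a = pᵐ} refl) (0ℤ-residues n))))
                        (≡⇒≡-mod refl) ⟩
        (residue x n ℤ.- residue α n) ℤ.- pᵐ ℤ.* + 0 ℤ.+ residue α n
          ≡⟨ lemma (residue x n) (residue α n) pᵐ ⟩
        residue x n ∎
        where
        lemma : ∀ a b q → (a ℤ.- b) ℤ.- q ℤ.* + 0 ℤ.+ b ≡ a
        lemma = ℤ-Solver.solve-∀

    network-computes-fα : ∀ x → eval network (λ _ → ι x) zero ≈ ι (fα m α x)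
    network-computes-fα x = by-cases (trunc x m ℕ.≟ trunc α m)
      where
      by-cases : Dec (trunc x m ≡ trunc α m) → eval network (λ _ → ι x) zero ≈ ι (fα m α x)
      by-cases (yes x≡α) = ≈-≡-trans {eval network (λ _ → ι x) zero} {ι α} {ι (fα m α x)}
                             (network-inside-ball x x≡α) (cong ι (sym (fα-inside m α x x≡α)))
      by-cases (no x≢α)  = ≈-≡-trans {eval network (λ _ → ι x) zero} {ι x} {ι (fα m α x)}
                             (network-outside-ball x x≢α) (cong ι (sym (fα-outside m α x x≢α)))

    network-of-width-2 : Σ (Net 1 1) (λ N → (width N ≡ 2) × (∀ x → eval N (λ _ → ι x) zero ≈ ι (fα m α x)))
    network-of-width-2 = network , refl , network-computes-fα

-- The construction works for m = 0 as well.
lemma3p8 : (p : ℕ) (pr : Prime p) (m : ℕ) → 1 ≤ m →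
    let open Padic p pr in
    (α : ℤp) →
    Σ (Net 1 1) (λ N →
      (width N ≡ 2) ×
      (∀ (x : ℤp) → eval N (λ _ → ι x) zero ≈ ι (fα m α x)))
lemma3p8 p pr m _ α = CollapseBall.network-of-width-2 p pr m α
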